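{- Let $N$ be a positive integer and $\mathbf{v}=(1,b,c)$ with integers $1<b<c<N$. Then $\lambda^{\ast}(\Pi_{N,\mathbf{v}}) = \lambda_1(\Lambda(\Pi_{N,\mathbf{v}}))$.
   Context: For $\mathbf{v}=(1,b,c)$ define $\Pi_{N,\mathbf{v}}:=\{ (n \bmod N,\ nb \bmod N,\ nc \bmod N) : 0 \leq n < N\}$ (residues in $\{0,\dots,N-1\}$), and $\lambda^{\ast}(\Pi_{N,\mathbf{v}}):=\min_{\mathbf{x}\neq\mathbf{y},\ \mathbf{x},\mathbf{y}\in\Pi_{N,\mathbf{v}}}\|\mathbf{x}-\mathbf{y}\|$ (Euclidean norm). $\Lambda(\Pi_{N,\mathbf{v}})$ denotes the underlying lattice $\begin{pmatrix} 0 & 0 & 1 \\ 0 & N & b \\ N & 0 & c \end{pmatrix}\mathbb{Z}^3$, whose intersection with $[0,N-1]^3$ is $\Pi_{N,\mathbf{v}}$, and $\lambda_1(\Lambda)$ is the length of a shortest nonzero vector of the lattice $\Lambda$. The statement is used (implicitly) for $N$ sufficiently large. -}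

module Defs where

open import Data.Nat as ℕ using (ℕ; NonZero; _<_; _%_)
open import Data.Integer as ℤ using (ℤ; +_; _-_; _+_; _*_; _≤_)
open import Data.Product using (_×_; _,_; Σ; ∃; ∃-syntax)
open import Relation.Binary.PropositionalEquality using (_≡_; _≢_)

Point : Set
Point = ℤ × ℤ × ℤ

origin : Point
origin = (+ 0 , + 0 , + 0)

sqNorm : Point → ℤ
sqNorm (x₁ , x₂ , x₃) = x₁ * x₁ + x₂ * x₂ + x₃ * x₃

_⊖_ : Point → Point → Point
(x₁ , x₂ , x₃) ⊖ (y₁ , y₂ , y₃) = (x₁ - y₁ , x₂ - y₂ , x₃ - y₃)

InΠ : (N b c : ℕ) → .{{NonZero N}} → Point → Set
InΠ N b c x = ∃[ n ] (n < N × x ≡ (+ (n % N) , + ((n ℕ.* b) % N) , + ((n ℕ.* c) % N)))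

-- the lattice Λ = M ℤ³ with M = [[0,0,1],[0,N,b],[N,0,c]]
InΛ : (N b c : ℕ) → Point → Set
InΛ N b c x = ∃[ k₁ ] ∃[ k₂ ] ∃[ k₃ ]
  (x ≡ (k₃ , + N * k₂ + + b * k₃ , + N * k₁ + + c * k₃))

-- d = (λ*(Π))² : the minimal squared distance between distinct points of Π
IsSqMinDistΠ : (N b c : ℕ) → .{{NonZero N}} → ℕ → Set
IsSqMinDistΠ N b c d =
  (∃[ x ] ∃[ y ] (InΠ N b c x × InΠ N b c y × x ≢ y × sqNorm (x ⊖ y) ≡ + d))
  × (∀ x y → InΠ N b c x → InΠ N b c y → x ≢ y → + d ≤ sqNorm (x ⊖ y))

-- d = (λ₁(Λ))² : the minimal squared norm of a nonzero lattice vector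
IsSqλ₁ : (N b c : ℕ) → ℕ → Set
IsSqλ₁ N b c d =
  (∃[ w ] (InΛ N b c w × w ≢ origin × sqNorm w ≡ + d))
  × (∀ w → InΛ N b c w → w ≢ origin → + d ≤ sqNorm w)

module Submission where

-- The minimal distance between distinct points of the Korobov-type set
--   Π = { P n = (n mod N, nb mod N, nc mod N) : 0 ≤ n < N }
-- equals the length of a shortest nonzero vector of the lattice
--   Λ = { (x, y, z) ∈ ℤ³ : y ≡ b x and z ≡ c x (mod N) },
-- which contains Π and is closed under differences (so λ*(Π) ≥ λ₁(Λ)).
--
-- For the converse, reduce a nonzero w ∈ Λ coordinatewise mod N: w is
-- congruent to a point P n.  If n ≠ 0, compare P n with P (2n mod N):
-- each coordinate of the difference is  U - (2U mod N), whose absolute value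
-- is the distance  min(U, N - U)  from U to Nℤ, hence at most the absolute
-- value of any integer ≡ U (mod N), in particular of the coordinate of w.
-- If n = 0, all coordinates of w are multiples of N, so |w|² ≥ N², while the
-- pair P 1, P 2 is at squared distance ≤ 1 + N²/4 + N²/4 ≤ N².

open import Defs
open import Data.Nat using (ℕ; NonZero; _<_)
open import Data.Product using (_×_; ∃-syntax)

open import Data.Nat as ℕ using (zero; suc; _≤_; s≤s⁻¹; z<s; _∸_; _⊓_; _<?_)
open import Data.Nat.Properties
open import Data.Nat.DivMod
  using (_%_; _/_; m%n<n; m<n⇒m%n≡m; [m+n]%n≡m%n; m≡m%n+[m/n]*n; m*n%n≡0;
         m%n%n≡m%n; %-distribˡ-+; %-distribˡ-*)
open import Data.Integer as ℤ using (ℤ; +_; -[1+_]; ∣_∣; _+_; _-_; _*_; -_)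
open import Data.Integer.Properties as ℤP
  using (pos-+; pos-*; m-n≡m⊖n; ⊖-≥; ∣⊖∣-≤; abs-*; ∣i∣≡0⇒i≡0; i-j≡0⇒i≡j;
         neg-distribˡ-*)
open import Data.Integer.DivMod using (_%ℕ_; _/ℕ_; n%ℕd<d; a≡a%ℕn+[a/ℕn]*n)
open import Data.Integer.Tactic.RingSolver using (solve-∀)
open import Data.Fin using (Fin; toℕ; fromℕ<)
open import Data.Fin.Properties using (any?; toℕ<n; toℕ-fromℕ<)
open import Data.Product using (_,_; ∃; proj₁; proj₂)
open import Data.Product.Properties using (≡-dec)
open import Data.Sum using (_⊎_; inj₁; inj₂)
open import Data.Empty using (⊥-elim)
open import Function using (_$_; _∘_)
open import Relation.Binary.PropositionalEquality
open import Relation.Nullary using (¬_; Dec; yes; no)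
open import Relation.Nullary.Decidable using (_×-dec_; ¬?)

sqNormℕ : Point → ℕ
sqNormℕ (x , y , z) = ∣ x ∣ ℕ.* ∣ x ∣ ℕ.+ ∣ y ∣ ℕ.* ∣ y ∣ ℕ.+ ∣ z ∣ ℕ.* ∣ z ∣

square-abs : ∀ a → a * a ≡ + (∣ a ∣ ℕ.* ∣ a ∣)
square-abs (+ n)    = sym (pos-* n n)
square-abs -[1+ n ] = refl

sqNorm≡sqNormℕ : ∀ p → sqNorm p ≡ + sqNormℕ p
sqNorm≡sqNormℕ (x , y , z)
  rewrite square-abs x | square-abs y | square-abs z
        | pos-+ (∣ x ∣ ℕ.* ∣ x ∣) (∣ y ∣ ℕ.* ∣ y ∣)
        | pos-+ (∣ x ∣ ℕ.* ∣ x ∣ ℕ.+ ∣ y ∣ ℕ.* ∣ y ∣) (∣ z ∣ ℕ.* ∣ z ∣) = refl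

≤-sqNorm : ∀ {d} p → d ≤ sqNormℕ p → + d ℤ.≤ sqNorm p
≤-sqNorm p d≤ = subst (+ _ ℤ.≤_) (sym (sqNorm≡sqNormℕ p)) (ℤ.+≤+ d≤)

⊖≡origin⇒≡ : ∀ p q → p ⊖ q ≡ origin → p ≡ q
⊖≡origin⇒≡ (x , y , z) (x′ , y′ , z′) eq =
  cong₂ _,_ (i-j≡0⇒i≡j x x′ (cong proj₁ eq))
            (cong₂ _,_ (i-j≡0⇒i≡j y y′ (cong (proj₁ ∘ proj₂) eq)) (i-j≡0⇒i≡j z z′ (cong (proj₂ ∘ proj₂) eq)))

_≟ₚ_ : (p q : Point) → Dec (p ≡ q)
_≟ₚ_ = ≡-dec ℤ._≟_ (≡-dec ℤ._≟_ ℤ._≟_)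

sqNormℕ-mono : ∀ {x y z x′ y′ z′} → ∣ x ∣ ≤ ∣ x′ ∣ → ∣ y ∣ ≤ ∣ y′ ∣ → ∣ z ∣ ≤ ∣ z′ ∣ →
               sqNormℕ (x , y , z) ≤ sqNormℕ (x′ , y′ , z′)
sqNormℕ-mono p q r = +-mono-≤ (+-mono-≤ (*-mono-≤ p p) (*-mono-≤ q q)) (*-mono-≤ r r)

coordinate-long : ∀ N x y z → N ≤ ∣ x ∣ ⊎ N ≤ ∣ y ∣ ⊎ N ≤ ∣ z ∣ → N ℕ.* N ≤ sqNormℕ (x , y , z)
coordinate-long N x y z (inj₁ h)        = ≤-trans (*-mono-≤ h h) (≤-trans (m≤m+n _ _) (m≤m+n _ _))
coordinate-long N x y z (inj₂ (inj₁ h)) = ≤-trans (*-mono-≤ h h) (≤-trans (m≤n+m _ (∣ x ∣ ℕ.* ∣ x ∣)) (m≤m+n _ _))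
coordinate-long N x y z (inj₂ (inj₂ h)) = ≤-trans (*-mono-≤ h h) (m≤n+m _ _)

small-sqNorm : ∀ N a x y → a ≤ 1 → x ℕ.+ x ≤ N → y ℕ.+ y ≤ N → 2 ≤ N →
               a ℕ.* a ℕ.+ x ℕ.* x ℕ.+ y ℕ.* y ≤ N ℕ.* N
small-sqNorm N a x y a≤1 2x≤N 2y≤N 2≤N = *-cancelˡ-≤ 4 (begin
    4 ℕ.* (a ℕ.* a ℕ.+ x ℕ.* x ℕ.+ y ℕ.* y)                          ≡⟨ quadruple a x y ⟩
    (a ℕ.+ a) ℕ.* (a ℕ.+ a) ℕ.+ (x ℕ.+ x) ℕ.* (x ℕ.+ x) ℕ.+ (y ℕ.+ y) ℕ.* (y ℕ.+ y)
      ≤⟨ +-mono-≤ (+-mono-≤ (*-mono-≤ 2a≤N 2a≤N) (*-mono-≤ 2x≤N 2x≤N)) (*-mono-≤ 2y≤N 2y≤N) ⟩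
    N ℕ.* N ℕ.+ N ℕ.* N ℕ.+ N ℕ.* N                                    ≤⟨ m≤n+m _ (N ℕ.* N) ⟩
    N ℕ.* N ℕ.+ (N ℕ.* N ℕ.+ N ℕ.* N ℕ.+ N ℕ.* N)                      ≡⟨ four-copies (N ℕ.* N) ⟩
    4 ℕ.* (N ℕ.* N)                                                    ∎)
  where
  open ≤-Reasoning
  import Data.Nat.Tactic.RingSolver as ℕSolver
  quadruple : ∀ a x y → 4 ℕ.* (a ℕ.* a ℕ.+ x ℕ.* x ℕ.+ y ℕ.* y)
            ≡ (a ℕ.+ a) ℕ.* (a ℕ.+ a) ℕ.+ (x ℕ.+ x) ℕ.* (x ℕ.+ x) ℕ.+ (y ℕ.+ y) ℕ.* (y ℕ.+ y)
  quadruple = ℕSolver.solve-∀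
  four-copies : ∀ M → M ℕ.+ (M ℕ.+ M ℕ.+ M) ≡ 4 ℕ.* M
  four-copies = ℕSolver.solve-∀
  2a≤N : a ℕ.+ a ≤ N
  2a≤N = ≤-trans (+-mono-≤ a≤1 a≤1) 2≤N

IsLeast : (ℕ → Set) → ℕ → Set
IsLeast Q d = Q d × (∀ e → Q e → d ≤ e)

module _ {Q : ℕ → Set} (Q? : ∀ e → Dec (Q e)) where

  search : ∀ k → ∃[ d ] IsLeast Q d ⊎ (∀ e → e < k → ¬ Q e)
  search zero = inj₂ (λ _ ())
  search (suc k) with search k | Q? k
  ... | inj₁ least | _      = inj₁ least
  ... | inj₂ none  | yes qk = inj₁ (k , qk , λ e qe → ≮⇒≥ (λ e<k → none e e<k qe))
  ... | inj₂ none  | no ¬qk = inj₂ below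
    where
    below : ∀ e → e < suc k → ¬ Q e
    below e e<1+k with m≤n⇒m<n∨m≡n (s≤s⁻¹ e<1+k)
    ... | inj₁ e<k  = none e e<k
    ... | inj₂ refl = ¬qk

  least : ∀ k → Q k → ∃[ d ] IsLeast Q d
  least k qk with search (suc k)
  ... | inj₁ found = found
  ... | inj₂ none  = ⊥-elim (none k ≤-refl qk)

module Residues (N : ℕ) .{{_ : NonZero N}} where

  infix 4 _≋_ _≋ₚ_

  record _≋_ (t u : ℤ) : Set where
    constructor mk≋
    field
      quotient : ℤ
      t≡u+qN   : t ≡ u + quotient * + N

  _≋ₚ_ : Point → Point → Set
  (x , y , z) ≋ₚ (x′ , y′ , z′) = x ≋ x′ × y ≋ y′ × z ≋ z′

  ≋-sym : ∀ {t u} → t ≋ u → u ≋ t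
  ≋-sym {t} {u} (mk≋ q t≡) = mk≋ (- q) (trans (shift u q (+ N)) (cong (_+ - q * + N) (sym t≡)))
    where
    shift : ∀ u q n → u ≡ (u + q * n) + - q * n
    shift = solve-∀

  ≋-trans : ∀ {t u v} → t ≋ u → u ≋ v → t ≋ v
  ≋-trans {v = v} (mk≋ q t≡) (mk≋ r u≡) =
    mk≋ (r + q) (trans t≡ (trans (cong (_+ q * + N) u≡) (merge v r q (+ N))))
    where
    merge : ∀ v r q n → (v + r * n) + q * n ≡ v + (r + q) * n
    merge = solve-∀

  ≋-*ˡ : ∀ k {t u} → t ≋ u → k * t ≋ k * u
  ≋-*ˡ k {u = u} (mk≋ q t≡) = mk≋ (k * q) (trans (cong (k *_) t≡) (distrib k u q (+ N)))
    where
    distrib : ∀ k u q n → k * (u + q * n) ≡ k * u + (k * q) * n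
    distrib = solve-∀

  ≋-multiple : ∀ k t → + N * k + t ≋ t
  ≋-multiple k t = mk≋ k (swap (+ N) k t)
    where
    swap : ∀ n k t → n * k + t ≡ t + k * n
    swap = solve-∀

  ≋-% : ∀ m → + m ≋ + (m % N)
  ≋-% m = mk≋ (+ (m / N)) (begin
    + m                             ≡⟨ cong +_ (m≡m%n+[m/n]*n m N) ⟩
    + (m % N ℕ.+ m / N ℕ.* N)       ≡⟨ pos-+ (m % N) (m / N ℕ.* N) ⟩
    + (m % N) + + (m / N ℕ.* N)     ≡⟨ cong (λ s → + (m % N) + s) (pos-* (m / N) N) ⟩
    + (m % N) + + (m / N) * + N     ∎)
    where open ≡-Reasoning

  ≋-%ℕ : ∀ t → t ≋ + (t %ℕ N)
  ≋-%ℕ t = mk≋ (t /ℕ N) (a≡a%ℕn+[a/ℕn]*n t N)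

  ≋-scale : ∀ β {t n} → t ≋ + n → + β * t ≋ + ((n ℕ.* β) % N)
  ≋-scale β {n = n} t≋n =
    ≋-trans (≋-*ˡ (+ β) t≋n)
            (subst (_≋ + ((n ℕ.* β) % N)) β*n≡nβ (≋-% (n ℕ.* β)))
    where
    β*n≡nβ : + (n ℕ.* β) ≡ + β * + n
    β*n≡nβ = trans (pos-* n β) (ℤP.*-comm (+ n) (+ β))

  dist : ℕ → ℕ
  dist U = U ⊓ (N ∸ U)

  dist-pos : ∀ {U} → 0 < U → U < N → 0 < dist U
  dist-pos 0<U U<N = ⊓-glb 0<U (m<n⇒0<n∸m U<N)

  dist-half : ∀ {U} → U < N → dist U ℕ.+ dist U ≤ N
  dist-half {U} U<N =
    ≤-trans (+-mono-≤ (m⊓n≤m U (N ∸ U)) (m⊓n≤n U (N ∸ U))) (≤-reflexive (m+[n∸m]≡n (<⇒≤ U<N)))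

  congruent-abs : ∀ {t U} → U < N → t ≋ + U → U ≤ ∣ t ∣ ⊎ N ∸ U ≤ ∣ t ∣
  congruent-abs {t} {U} U<N (mk≋ (+ k) t≡) = inj₁ (subst (U ≤_) (sym ∣t∣≡) (m≤m+n U (k ℕ.* N)))
    where
    ∣t∣≡ : ∣ t ∣ ≡ U ℕ.+ k ℕ.* N
    ∣t∣≡ = cong ∣_∣ (trans t≡ (trans (cong (λ s → + U + s) (sym (pos-* k N))) (sym (pos-+ U (k ℕ.* N)))))
  congruent-abs {t} {U} U<N (mk≋ -[1+ k ] t≡) = inj₂ (m≤n+o⇒m∸n≤o N U (subst (N ≤_) (sym U+∣t∣≡M) N≤M))
    where
    M = suc k ℕ.* N
    N≤M : N ≤ M
    N≤M = m≤m+n N (k ℕ.* N)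
    U≤M : U ≤ M
    U≤M = ≤-trans (<⇒≤ U<N) N≤M
    t≡U⊖M : t ≡ U ℤ.⊖ M
    t≡U⊖M = trans t≡ (trans (cong (λ s → + U + s) (sym (neg-distribˡ-* (+ suc k) (+ N))))
                       (trans (cong (λ m → + U - m) (sym (pos-* (suc k) N))) (m-n≡m⊖n U M)))
    U+∣t∣≡M : U ℕ.+ ∣ t ∣ ≡ M
    U+∣t∣≡M = trans (cong (λ s → U ℕ.+ ∣ s ∣) t≡U⊖M) (trans (cong (U ℕ.+_) (∣⊖∣-≤ U≤M)) (m+[n∸m]≡n U≤M))

  dist-minimal : ∀ {t U} → U < N → t ≋ + U → dist U ≤ ∣ t ∣
  dist-minimal {U = U} U<N t≋U with congruent-abs U<N t≋U
  ... | inj₁ U≤∣t∣   = ≤-trans (m⊓n≤m U (N ∸ U)) U≤∣t∣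
  ... | inj₂ N-U≤∣t∣ = ≤-trans (m⊓n≤n U (N ∸ U)) N-U≤∣t∣

  multiple-abs : ∀ {t} → t ≋ + 0 → t ≡ + 0 ⊎ N ≤ ∣ t ∣
  multiple-abs {t} (mk≋ q t≡) = by-quotient ∣ q ∣ ∣t∣≡∣q∣N
    where
    ∣t∣≡∣q∣N : ∣ t ∣ ≡ ∣ q ∣ ℕ.* N
    ∣t∣≡∣q∣N = trans (cong ∣_∣ (trans t≡ (ℤP.+-identityˡ (q * + N)))) (abs-* q (+ N))
    by-quotient : ∀ k → ∣ t ∣ ≡ k ℕ.* N → t ≡ + 0 ⊎ N ≤ ∣ t ∣
    by-quotient zero    ∣t∣≡0  = inj₁ (∣i∣≡0⇒i≡0 ∣t∣≡0)
    by-quotient (suc k) ∣t∣≡kN = inj₂ (subst (N ≤_) (sym ∣t∣≡kN) (m≤m+n N (k ℕ.* N)))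

  fold : ℕ → ℤ
  fold U = + U - + ((U ℕ.+ U) % N)

  -- when 2U ≥ N, the residue of 2U is 2U - N = U - (N - U)
  wrapped-double : ∀ {U} → U < N → N ≤ U ℕ.+ U → (U ℕ.+ U) % N ≡ U ∸ (N ∸ U)
  wrapped-double {U} U<N N≤2U = begin
    (U ℕ.+ U) % N                   ≡⟨ cong (_% N) (sym r+N≡2U) ⟩
    (r ℕ.+ N) % N                   ≡⟨ [m+n]%n≡m%n r N ⟩
    r % N                           ≡⟨ m<n⇒m%n≡m (≤-<-trans (m∸n≤m U (N ∸ U)) U<N) ⟩
    r                               ∎
    where
    open ≡-Reasoning
    r = U ∸ (N ∸ U)
    N-U≤U : N ∸ U ≤ U
    N-U≤U = m≤n+o⇒m∸n≤o N U N≤2U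
    r+N≡2U : r ℕ.+ N ≡ U ℕ.+ U
    r+N≡2U = begin
      r ℕ.+ N                       ≡⟨ cong (r ℕ.+_) (sym (m∸n+n≡m (<⇒≤ U<N))) ⟩
      r ℕ.+ ((N ∸ U) ℕ.+ U)         ≡⟨ sym (+-assoc r (N ∸ U) U) ⟩
      r ℕ.+ (N ∸ U) ℕ.+ U           ≡⟨ cong (ℕ._+ U) (m∸n+n≡m N-U≤U) ⟩
      U ℕ.+ U                       ∎

  ∣fold∣≡dist : ∀ {U} → U < N → ∣ fold U ∣ ≡ dist U
  ∣fold∣≡dist {U} U<N with U ℕ.+ U <? N
  ... | yes 2U<N = begin
    ∣ fold U ∣                      ≡⟨ cong (λ r → ∣ + U - + r ∣) (m<n⇒m%n≡m 2U<N) ⟩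
    ∣ + U - + (U ℕ.+ U) ∣           ≡⟨ cong ∣_∣ (m-n≡m⊖n U (U ℕ.+ U)) ⟩
    ∣ U ℤ.⊖ (U ℕ.+ U) ∣             ≡⟨ ∣⊖∣-≤ (m≤m+n U U) ⟩
    U ℕ.+ U ∸ U                     ≡⟨ m+n∸m≡n U U ⟩
    U                               ≡⟨ sym (m≤n⇒m⊓n≡m (m+n≤o⇒m≤o∸n U (<⇒≤ 2U<N))) ⟩
    dist U                          ∎
    where open ≡-Reasoning
  ... | no 2U≮N = begin
    ∣ fold U ∣                      ≡⟨ cong (λ r → ∣ + U - + r ∣) (wrapped-double U<N N≤2U) ⟩
    ∣ + U - + (U ∸ (N ∸ U)) ∣       ≡⟨ cong ∣_∣ (m-n≡m⊖n U (U ∸ (N ∸ U))) ⟩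
    ∣ U ℤ.⊖ (U ∸ (N ∸ U)) ∣         ≡⟨ cong ∣_∣ (⊖-≥ (m∸n≤m U (N ∸ U))) ⟩
    U ∸ (U ∸ (N ∸ U))               ≡⟨ m∸[m∸n]≡n N-U≤U ⟩
    N ∸ U                           ≡⟨ sym (m≥n⇒m⊓n≡n N-U≤U) ⟩
    dist U                          ∎
    where
    open ≡-Reasoning
    N≤2U : N ≤ U ℕ.+ U
    N≤2U = ≮⇒≥ 2U≮N
    N-U≤U : N ∸ U ≤ U
    N-U≤U = m≤n+o⇒m∸n≤o N U N≤2U

  fold-minimal : ∀ {t U} → U < N → t ≋ + U → ∣ fold U ∣ ≤ ∣ t ∣
  fold-minimal U<N t≋U = subst (_≤ _) (sym (∣fold∣≡dist U<N)) (dist-minimal U<N t≋U)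

  %-*-absorb : ∀ m β → ((m % N) ℕ.* β) % N ≡ (m ℕ.* β) % N
  %-*-absorb m β = begin
    ((m % N) ℕ.* β) % N             ≡⟨ %-distribˡ-* (m % N) β N ⟩
    ((m % N % N) ℕ.* (β % N)) % N   ≡⟨ cong (λ r → (r ℕ.* (β % N)) % N) (m%n%n≡m%n m N) ⟩
    ((m % N) ℕ.* (β % N)) % N       ≡⟨ sym (%-distribˡ-* m β N) ⟩
    (m ℕ.* β) % N                   ∎
    where open ≡-Reasoning

  double-residue : ∀ m β → (((m ℕ.+ m) % N) ℕ.* β) % N ≡ ((m ℕ.* β) % N ℕ.+ (m ℕ.* β) % N) % N
  double-residue m β = begin
    (((m ℕ.+ m) % N) ℕ.* β) % N     ≡⟨ %-*-absorb (m ℕ.+ m) β ⟩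
    ((m ℕ.+ m) ℕ.* β) % N           ≡⟨ cong (_% N) (*-distribʳ-+ β m m) ⟩
    (m ℕ.* β ℕ.+ m ℕ.* β) % N       ≡⟨ %-distribˡ-+ (m ℕ.* β) (m ℕ.* β) N ⟩
    ((m ℕ.* β) % N ℕ.+ (m ℕ.* β) % N) % N ∎
    where open ≡-Reasoning

module Lattice (N b c : ℕ) .{{_ : NonZero N}} where
  open Residues N

  P : ℕ → Point
  P n = (+ (n % N) , + ((n ℕ.* b) % N) , + ((n ℕ.* c) % N))

  InΛ-intro : ∀ {x y z} → y ≋ + b * x → z ≋ + c * x → InΛ N b c (x , y , z)
  InΛ-intro {x} (mk≋ qy y≡) (mk≋ qz z≡) =
    qz , qy , x , cong₂ _,_ refl (cong₂ _,_ (trans y≡ (reorder (+ b) x qy (+ N)))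
                                            (trans z≡ (reorder (+ c) x qz (+ N))))
    where
    reorder : ∀ β x q n → β * x + q * n ≡ n * q + β * x
    reorder = solve-∀

  InΛ-⊖ : ∀ {p q} → InΛ N b c p → InΛ N b c q → InΛ N b c (p ⊖ q)
  InΛ-⊖ (k₁ , k₂ , k₃ , refl) (l₁ , l₂ , l₃ , refl) =
    k₁ - l₁ , k₂ - l₂ , k₃ - l₃ ,
    cong₂ _,_ refl (cong₂ _,_ (difference (+ N) (+ b) k₂ k₃ l₂ l₃)
                              (difference (+ N) (+ c) k₁ k₃ l₁ l₃))
    where
    difference : ∀ n β k j l m → (n * k + β * j) - (n * l + β * m) ≡ n * (k - l) + β * (j - m)
    difference = solve-∀

  P∈Λ : ∀ n → InΛ N b c (P n)
  P∈Λ n = InΛ-intro (residue b) (residue c)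
    where
    residue : ∀ β → + ((n ℕ.* β) % N) ≋ + β * + (n % N)
    residue β = ≋-sym (≋-scale β (≋-sym (≋-% n)))

  lattice-residue : ∀ {w} → InΛ N b c w → ∃[ n ] (n < N × w ≋ₚ P n)
  lattice-residue (k₁ , k₂ , k₃ , refl) =
    n , n%ℕd<d k₃ N , ≋-trans (≋-%ℕ k₃) (≋-% n) , coordinate b k₂ , coordinate c k₁
    where
    n = k₃ %ℕ N
    coordinate : ∀ β k → + N * k + + β * k₃ ≋ + ((n ℕ.* β) % N)
    coordinate β k = ≋-trans (≋-multiple k (+ β * k₃)) (≋-scale β (≋-%ℕ k₃))

  halving-difference : ∀ n →
    P n ⊖ P ((n ℕ.+ n) % N) ≡ (fold (n % N) , fold ((n ℕ.* b) % N) , fold ((n ℕ.* c) % N))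
  halving-difference n =
    cong₂ _,_ (cong (λ r → + (n % N) - + r) (trans (m%n%n≡m%n (n ℕ.+ n) N) (%-distribˡ-+ n n N)))
              (cong₂ _,_ (coordinate b) (coordinate c))
    where
    coordinate : ∀ β → + ((n ℕ.* β) % N) - + ((((n ℕ.+ n) % N) ℕ.* β) % N) ≡ fold ((n ℕ.* β) % N)
    coordinate β = cong (λ r → + ((n ℕ.* β) % N) - + r) (double-residue n β)

  halving-distinct : ∀ n → 0 < n % N → P n ≢ P ((n ℕ.+ n) % N)
  halving-distinct n 0<n eq = <⇒≢ (dist-pos 0<n (m%n<n n N)) (sym dist≡0)
    where
    fold≡0 : fold (n % N) ≡ + 0
    fold≡0 = begin
      fold (n % N)                          ≡⟨ cong proj₁ (halving-difference n) ⟨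
      proj₁ (P n ⊖ P ((n ℕ.+ n) % N))       ≡⟨ cong (λ p → proj₁ (P n ⊖ p)) eq ⟨
      + (n % N) - + (n % N)                 ≡⟨ ℤP.+-inverseʳ (+ (n % N)) ⟩
      + 0                                   ∎
      where open ≡-Reasoning
    dist≡0 : dist (n % N) ≡ 0
    dist≡0 = trans (sym (∣fold∣≡dist (m%n<n n N))) (cong ∣_∣ fold≡0)

  halving-short : ∀ {w n} → w ≋ₚ P n → sqNormℕ (P n ⊖ P ((n ℕ.+ n) % N)) ≤ sqNormℕ w
  halving-short {x , y , z} {n} (x≋ , y≋ , z≋) =
    subst (λ p → sqNormℕ p ≤ sqNormℕ (x , y , z)) (sym (halving-difference n)) $
    sqNormℕ-mono {fold (n % N)} {fold ((n ℕ.* b) % N)} {fold ((n ℕ.* c) % N)} {x} {y} {z}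
                 (fold-minimal (m%n<n n N) x≋) (fold-minimal (m%n<n (n ℕ.* b) N) y≋)
                 (fold-minimal (m%n<n (n ℕ.* c) N) z≋)

  P₁-P₂-short : 1 < N → sqNormℕ (P 1 ⊖ P (2 % N)) ≤ N ℕ.* N
  P₁-P₂-short 1<N = subst (λ p → sqNormℕ p ≤ N ℕ.* N) (sym (halving-difference 1))
    (small-sqNorm N (∣ fold (1 % N) ∣) (∣ fold ((1 ℕ.* b) % N) ∣) (∣ fold ((1 ℕ.* c) % N) ∣) first-short (fold-half (1 ℕ.* b)) (fold-half (1 ℕ.* c)) 1<N)
    where
    first-short : ∣ fold (1 % N) ∣ ≤ 1
    first-short = begin
      ∣ fold (1 % N) ∣  ≡⟨ ∣fold∣≡dist (m%n<n 1 N) ⟩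
      dist (1 % N)      ≤⟨ m⊓n≤m (1 % N) (N ∸ 1 % N) ⟩
      1 % N             ≡⟨ m<n⇒m%n≡m 1<N ⟩
      1                 ∎
      where open ≤-Reasoning
    fold-half : ∀ m → ∣ fold (m % N) ∣ ℕ.+ ∣ fold (m % N) ∣ ≤ N
    fold-half m = subst (λ d → d ℕ.+ d ≤ N) (sym (∣fold∣≡dist (m%n<n m N))) (dist-half (m%n<n m N))

  multiple-long : ∀ {w} → w ≋ₚ P 0 → w ≢ origin → N ℕ.* N ≤ sqNormℕ w
  multiple-long {x , y , z} (x≋ , y≋ , z≋) w≢0
    with multiple-abs (to-zero x≋) | multiple-abs (to-zero y≋) | multiple-abs (to-zero z≋)
    where
    to-zero : ∀ {t} → t ≋ + (0 % N) → t ≋ + 0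
    to-zero = subst (λ r → _ ≋ + r) (m*n%n≡0 0 N)
  ... | inj₂ h    | _         | _         = coordinate-long N x y z (inj₁ h)
  ... | inj₁ _    | inj₂ h    | _         = coordinate-long N x y z (inj₂ (inj₁ h))
  ... | inj₁ _    | inj₁ _    | inj₂ h    = coordinate-long N x y z (inj₂ (inj₂ h))
  ... | inj₁ refl | inj₁ refl | inj₁ refl = ⊥-elim (w≢0 refl)

  P₁≢P₂ : 1 < N → P 1 ≢ P (2 % N)
  P₁≢P₂ 1<N = halving-distinct 1 (subst (0 <_) (sym (m<n⇒m%n≡m 1<N)) z<s)

  shortest-difference : 1 < N → ∀ {w} → InΛ N b c w → w ≢ origin →
    ∃[ n ] ∃[ m ] (n < N × m < N × P n ≢ P m × sqNormℕ (P n ⊖ P m) ≤ sqNormℕ w)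
  shortest-difference 1<N w∈Λ w≢0 with lattice-residue w∈Λ
  ... | zero , _ , w≋P₀ =
    1 , 2 % N , 1<N , m%n<n 2 N , P₁≢P₂ 1<N , ≤-trans (P₁-P₂-short 1<N) (multiple-long w≋P₀ w≢0)
  ... | suc n , 1+n<N , w≋Pn =
    suc n , (suc n ℕ.+ suc n) % N , 1+n<N , m%n<n _ N ,
    halving-distinct (suc n) (subst (0 <_) (sym (m<n⇒m%n≡m 1+n<N)) z<s) , halving-short w≋Pn

  Realised : ℕ → Set
  Realised e = ∃ λ (i : Fin N) → ∃ λ (j : Fin N) →
    P (toℕ i) ≢ P (toℕ j) × sqNormℕ (P (toℕ i) ⊖ P (toℕ j)) ≡ e

  realised? : ∀ e → Dec (Realised e)
  realised? e = any? λ i → any? λ j →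
    ¬? (P (toℕ i) ≟ₚ P (toℕ j)) ×-dec (sqNormℕ (P (toℕ i) ⊖ P (toℕ j)) ℕ.≟ e)

  realised : ∀ {n m} → n < N → m < N → P n ≢ P m → Realised (sqNormℕ (P n ⊖ P m))
  realised {n} {m} n<N m<N Pn≢Pm = fromℕ< n<N , fromℕ< m<N ,
    subst₂ (λ n′ m′ → P n′ ≢ P m′ × sqNormℕ (P n′ ⊖ P m′) ≡ sqNormℕ (P n ⊖ P m))
           (sym (toℕ-fromℕ< n<N)) (sym (toℕ-fromℕ< m<N)) (Pn≢Pm , refl)

  least-distance : 1 < N → ∃[ d ] IsLeast Realised d
  least-distance 1<N = least realised? _ (realised 1<N (m%n<n 2 N) (P₁≢P₂ 1<N))

  min-distance : ∀ {d} → IsLeast Realised d → IsSqMinDistΠ N b c d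
  min-distance ((i , j , Pi≢Pj , |Pi-Pj|²≡d) , minimal) =
    (P (toℕ i) , P (toℕ j) , (toℕ i , toℕ<n i , refl) , (toℕ j , toℕ<n j , refl) , Pi≢Pj ,
     trans (sqNorm≡sqNormℕ (P (toℕ i) ⊖ P (toℕ j))) (cong +_ |Pi-Pj|²≡d)) ,
    λ { _ _ (n , n<N , refl) (m , m<N , refl) Pn≢Pm →
        ≤-sqNorm (P n ⊖ P m) (minimal _ (realised n<N m<N Pn≢Pm)) }

  shortest-vector : 1 < N → ∀ {d} → IsLeast Realised d → IsSqλ₁ N b c d
  shortest-vector 1<N ((i , j , Pi≢Pj , |Pi-Pj|²≡d) , minimal) =
    (P (toℕ i) ⊖ P (toℕ j) , InΛ-⊖ (P∈Λ (toℕ i)) (P∈Λ (toℕ j)) , Pi≢Pj ∘ ⊖≡origin⇒≡ _ _ ,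
     trans (sqNorm≡sqNormℕ (P (toℕ i) ⊖ P (toℕ j))) (cong +_ |Pi-Pj|²≡d)) ,
    λ w w∈Λ w≢0 →
      let (n , m , n<N , m<N , Pn≢Pm , shorter) = shortest-difference 1<N w∈Λ w≢0
      in ≤-sqNorm w (≤-trans (minimal _ (realised n<N m<N Pn≢Pm)) shorter)

lemma2 : (N b c : ℕ) → .{{_ : NonZero N}} → 1 < b → b < c → c < N →
    ∃[ d ] (IsSqMinDistΠ N b c d × IsSqλ₁ N b c d)
lemma2 N b c 1<b b<c c<N =
  let (d , d-least) = least-distance 1<N
  in d , min-distance d-least , shortest-vector 1<N d-least
  where
  open Lattice N b c
  1<N : 1 < N
  1<N = <-trans 1<b (<-trans b<c c<N)
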